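{- Let $I\subset\mathbb{R}_{>0}$ have size $n$ with $\mathrm{OPT}_L(I) \le 2$, let $\varepsilon\in(0,1)$ and $0 < \delta \le \frac{\varepsilon}{9n}\max(I)$. Round each item of $I$ up to the nearest multiple of $\delta$ and call the resulting multiset $\widetilde I$. Let $\widetilde X,\widetilde Y\subseteq \widetilde I$ be disjoint with $\max(\widetilde I)\in\widetilde X\cup\widetilde Y$ and $R(\widetilde X,\widetilde Y) = \mathrm{OPT}_L(\widetilde I)$, and let $X,Y\subseteq I$ be the sets of original items corresponding to $\widetilde X,\widetilde Y$. Then $R(X,Y) \le (1+\varepsilon)\,\mathrm{OPT}_L(I)$.
   Context: $\Sigma(Z)$ is the sum of the elements of $Z$. $R(X,Y) := \max\{\Sigma(X)/\Sigma(Y), \Sigma(Y)/\Sigma(X)\}$, convention $x/0=\infty$ for $x\ge 0$. $\mathrm{OPT}_L(J) := \min\{R(X,Y)\mid X,Y\subseteq J\text{ disjoint}, \max(J)\in X\cup Y\}$. For multisets, sub-multisets are disjoint if for each value the sum of multiplicities is at most its multiplicity in the ambient multiset. -}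

module Defs where

open import Level using (0ℓ)
open import Data.Nat.Base as ℕ using (ℕ; zero; suc)
open import Data.Fin.Base using (Fin; zero; suc)
open import Data.Fin.Subset using (Subset; Side; inside; outside; _∈_)
open import Data.Vec.Base using (lookup)
open import Data.Product.Base using (Σ; ∃; _×_; _,_)
open import Data.Sum.Base using (_⊎_)
open import Relation.Nullary using (¬_)
open import Relation.Binary.Core using (Rel)
open import Relation.Binary.Definitions using (tri<; tri≈; tri>)
open import Relation.Binary.PropositionalEquality using (_≡_)
open import Relation.Binary.Structures using (IsStrictTotalOrder)
open import Algebra.Structures using (IsCommutativeRing)

record RealField : Set₁ where
  infixl 6 _+_
  infixl 7 _*_
  infix 4 _<_ _≤_
  field
    ℝ        : Set
    0ℝ 1ℝ    : ℝ
    _+_ _*_  : ℝ → ℝ → ℝ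
    -_       : ℝ → ℝ
    _⁻¹      : ℝ → ℝ
    _<_      : ℝ → ℝ → Set
    isCommutativeRing  : IsCommutativeRing _≡_ _+_ _*_ -_ 0ℝ 1ℝ
    ⁻¹-inverse         : ∀ x → ¬ (x ≡ 0ℝ) → x * (x ⁻¹) ≡ 1ℝ
    0≢1                : ¬ (0ℝ ≡ 1ℝ)
    isStrictTotalOrder : IsStrictTotalOrder _≡_ _<_
    +-mono-<           : ∀ {x y} z → x < y → x + z < y + z
    *-pos              : ∀ {x y} → 0ℝ < x → 0ℝ < y → 0ℝ < x * y

  _≤_ : ℝ → ℝ → Set
  x ≤ y = x < y ⊎ x ≡ y

  field
    complete : (P : ℝ → Set) → ∃ P → ∃ (λ b → ∀ x → P x → x ≤ b) →
               ∃ (λ s → (∀ x → P x → x ≤ s) ×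
                        (∀ b → (∀ x → P x → x ≤ b) → s ≤ b))

module Reals (ℛ : RealField) where
  open RealField ℛ public
  open IsStrictTotalOrder isStrictTotalOrder using (compare)

  fromℕ : ℕ → ℝ
  fromℕ zero    = 0ℝ
  fromℕ (suc n) = 1ℝ + fromℕ n

  max : ℝ → ℝ → ℝ
  max x y with compare x y
  ... | tri< _ _ _ = y
  ... | tri≈ _ _ _ = y
  ... | tri> _ _ _ = x

  data Ext : Set where
    fin : ℝ → Ext
    ∞   : Ext

  infix 4 _≤ᵉ_
  data _≤ᵉ_ : Ext → Ext → Set where
    fin≤fin : ∀ {x y} → x ≤ y → fin x ≤ᵉ fin y
    ≤∞      : ∀ {e} → e ≤ᵉ ∞

  scale : ℝ → Ext → Ext
  scale c (fin x) = fin (c * x)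
  scale c ∞       = ∞

  -- quotient x / y of nonnegative reals with the convention x/0 = ∞
  div : ℝ → ℝ → Ext
  div x y with compare y 0ℝ
  ... | tri≈ _ _ _ = ∞
  ... | _          = fin (x * (y ⁻¹))

  maxᵉ : Ext → Ext → Ext
  maxᵉ (fin x) (fin y) = fin (max x y)
  maxᵉ _       _       = ∞

  sumF : (n : ℕ) → (Fin n → ℝ) → ℝ
  sumF zero    f = 0ℝ
  sumF (suc n) f = f zero + sumF n (λ i → f (suc i))

  -- Σ(Z) for a sub-(multi)set Z of the items J, given by the indices it uses
  Σ[_] : ∀ {n} → (Fin n → ℝ) → Subset n → ℝ
  Σ[_] {n} J Z = sumF n (λ i → pick (lookup Z i) (J i))
    where
    pick : Side → ℝ → ℝ
    pick inside  x = x
    pick outside x = 0ℝ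

  R : ∀ {n} → (Fin n → ℝ) → Subset n → Subset n → Ext
  R J X Y = maxᵉ (div (Σ[ J ] X) (Σ[ J ] Y)) (div (Σ[ J ] Y) (Σ[ J ] X))

  Disjoint : ∀ {n} → Subset n → Subset n → Set
  Disjoint X Y = ∀ i → i ∈ X → i ∈ Y → Data.Empty.⊥
    where import Data.Empty

  IsMax : ∀ {n} → (Fin n → ℝ) → ℝ → Set
  IsMax J M = ∃ (λ i → J i ≡ M) × (∀ j → J j ≤ M)

  MaxIn : ∀ {n} → (Fin n → ℝ) → Subset n → Subset n → Set
  MaxIn J X Y = ∃ λ i → (i ∈ X ⊎ i ∈ Y) × (∀ j → J j ≤ J i)

  Admissible : ∀ {n} → (Fin n → ℝ) → Subset n → Subset n → Set
  Admissible J X Y = Disjoint X Y × MaxIn J X Y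

  IsOPT : ∀ {n} → (Fin n → ℝ) → Ext → Set
  IsOPT J o = (∃ λ X → ∃ λ Y → Admissible J X Y × R J X Y ≡ o)
            × (∀ X Y → Admissible J X Y → o ≤ᵉ R J X Y)

  RoundUp : ∀ {n} → ℝ → (Fin n → ℝ) → (Fin n → ℝ) → Set
  RoundUp δ J J̃ = ∀ i → ∃ λ (m : ℕ) →
    (J̃ i ≡ fromℕ m * δ) × (J i ≤ J̃ i) × (J̃ i < J i + δ)

{-# OPTIONS --safe #-}
module Submission where

-- Let (P, Q) attain OPT_L(I) = ρ ∈ [1, 2], put η = ε/9 and D = nδ ≤ ηM, a bound on the total
-- rounding error of any sum.  Rounding up is monotone, so (P, Q) stays admissible for Ĩ.  The
-- side holding the maximum has sum at least M, so M ≤ max(p, q) ≤ 2 min(p, q) and the sums of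
-- (P, Q) grow by at most D ≤ 2η min(p, q): their ratio on Ĩ is at most σ = ρ + 2η, and by
-- optimality so is that of (X̃, Ỹ).  Since σ ≤ 3 this gives M ≤ 3x̃, hence D ≤ 3ηx̃ and
-- x̃ ≤ (1 + 9η/2)x, so y ≤ ỹ ≤ σx̃ ≤ (ρ + 2η)(1 + 9η/2)x ≤ (1 + 9η)ρx = (1 + ε)ρx, and
-- symmetrically with x and y exchanged.

open import Defs
open import Data.Nat.Base using (ℕ)
open import Data.Fin.Base using (Fin)
open import Data.Fin.Subset using (Subset)
open import Function.Definitions using (Injective)
open import Relation.Binary.PropositionalEquality using (_≡_)

import Data.Nat.Base as ℕ
import Data.Nat.Properties as ℕ
open import Data.Fin.Base using (zero; suc)
open import Data.Fin.Subset using (inside; outside; _∈_)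
open import Data.Vec.Base using ([]; _∷_; here; there)
open import Data.Product.Base using (_×_; _,_)
open import Data.Sum.Base using (_⊎_; inj₁; inj₂; swap)
open import Data.Empty using (⊥-elim)
open import Relation.Nullary using (¬_)
open import Relation.Binary.Bundles using (StrictPartialOrder)
open import Relation.Binary.Definitions using (tri<; tri≈; tri>)
open import Relation.Binary.Structures using (IsStrictTotalOrder)
open import Relation.Binary.PropositionalEquality using (refl; sym; trans; cong; cong₂; subst; subst₂)
open import Algebra.Bundles using (CommutativeRing)
open import Algebra.Structures using (IsCommutativeRing)
import Algebra.Properties.Ring as RingProperties
import Algebra.Properties.Semiring.Mult.TCOptimised as SemiringMultiples
import Algebra.Solver.Ring.NaturalCoefficients.Default as NaturalCoefficientsSolver
import Relation.Binary.Reasoning.StrictPartialOrder as StrictPartialOrderReasoning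

module OrderedField (ℛ : RealField) where
  open Reals ℛ
  open IsStrictTotalOrder isStrictTotalOrder
    using (compare; isStrictPartialOrder) renaming (trans to <-trans; asym to <-asym)

  commutativeRing : CommutativeRing _ _
  commutativeRing = record { isCommutativeRing = isCommutativeRing }

  open CommutativeRing commutativeRing
    using (+-comm; +-identityˡ; +-identityʳ; -‿inverseʳ; *-comm; *-assoc; *-identityˡ; *-identityʳ;
           zeroˡ; zeroʳ; distribˡ; _-_)
  open RingProperties (CommutativeRing.ring commutativeRing) using (//-rightDividesˡ; -1*x≈-x; -‿involutive)
  open SemiringMultiples (CommutativeRing.semiring commutativeRing) using (1+×) renaming (_×_ to _×ℝ_)

  strictPartialOrder : StrictPartialOrder _ _ _
  strictPartialOrder = record { isStrictPartialOrder = isStrictPartialOrder }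

  module ≤-Reasoning = StrictPartialOrderReasoning strictPartialOrder
  open ≤-Reasoning

  <-irrefl : ∀ {x} → ¬ (x < x)
  <-irrefl = IsStrictTotalOrder.irrefl isStrictTotalOrder refl

  ≤-refl : ∀ {x} → x ≤ x
  ≤-refl = inj₂ refl

  <-≤-trans : ∀ {x y z} → x < y → y ≤ z → x < z
  <-≤-trans x<y (inj₁ y<z) = <-trans x<y y<z
  <-≤-trans x<y (inj₂ refl) = x<y

  ≤-trans : ∀ {x y z} → x ≤ y → y ≤ z → x ≤ z
  ≤-trans (inj₁ x<y) y≤z = inj₁ (<-≤-trans x<y y≤z)
  ≤-trans (inj₂ refl) y≤z = y≤z

  <⇒≱ : ∀ {x y} → x < y → ¬ (y ≤ x)
  <⇒≱ x<y y≤x = <-irrefl (<-≤-trans x<y y≤x)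

  ≮⇒≥ : ∀ {x y} → ¬ (x < y) → y ≤ x
  ≮⇒≥ {x} {y} x≮y with compare x y
  ... | tri< x<y _ _ = ⊥-elim (x≮y x<y)
  ... | tri≈ _ x≡y _ = inj₂ (sym x≡y)
  ... | tri> _ _ y<x = inj₁ y<x

  ≤ᵉ-trans : ∀ {a b c} → a ≤ᵉ b → b ≤ᵉ c → a ≤ᵉ c
  ≤ᵉ-trans (fin≤fin a≤b) (fin≤fin b≤c) = fin≤fin (≤-trans a≤b b≤c)
  ≤ᵉ-trans _ ≤∞ = ≤∞

  +-monoˡ-< : ∀ z {x y} → x < y → z + x < z + y
  +-monoˡ-< z {x} {y} x<y = subst₂ _<_ (+-comm x z) (+-comm y z) (+-mono-< z x<y)

  +-monoʳ-≤ : ∀ z {x y} → x ≤ y → x + z ≤ y + z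
  +-monoʳ-≤ z (inj₁ x<y) = inj₁ (+-mono-< z x<y)
  +-monoʳ-≤ z (inj₂ refl) = ≤-refl

  +-monoˡ-≤ : ∀ z {x y} → x ≤ y → z + x ≤ z + y
  +-monoˡ-≤ z (inj₁ x<y) = inj₁ (+-monoˡ-< z x<y)
  +-monoˡ-≤ z (inj₂ refl) = ≤-refl

  +-mono-≤ : ∀ {a b c d} → a ≤ b → c ≤ d → a + c ≤ b + d
  +-mono-≤ a≤b c≤d = ≤-trans (+-monoʳ-≤ _ a≤b) (+-monoˡ-≤ _ c≤d)

  +-cancelʳ-≤ : ∀ z {x y} → x + z ≤ y + z → x ≤ y
  +-cancelʳ-≤ z x+z≤y+z = ≮⇒≥ λ y<x → <⇒≱ (+-mono-< z y<x) x+z≤y+z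

  x≤x+y : ∀ {x y} → 0ℝ ≤ y → x ≤ x + y
  x≤x+y {x} 0≤y = subst (_≤ x + _) (+-identityʳ x) (+-monoˡ-≤ x 0≤y)

  y≤x+y : ∀ {x y} → 0ℝ ≤ x → y ≤ x + y
  y≤x+y {x} {y} 0≤x = subst (y ≤_) (+-comm y x) (x≤x+y 0≤x)

  0≤+ : ∀ {x y} → 0ℝ ≤ x → 0ℝ ≤ y → 0ℝ ≤ x + y
  0≤+ {x} {y} 0≤x 0≤y = subst (_≤ x + y) (+-identityʳ 0ℝ) (+-mono-≤ 0≤x 0≤y)

  0<1 : 0ℝ < 1ℝ
  0<1 with compare 0ℝ 1ℝ
  ... | tri< 0<1 _ _ = 0<1
  ... | tri≈ _ 0≡1 _ = ⊥-elim (0≢1 0≡1)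
  ... | tri> _ _ 1<0 = ⊥-elim (<-asym 1<0 (subst (0ℝ <_) -1*-1≡1 (*-pos 0<-1 0<-1)))
    where
    0<-1 : 0ℝ < - 1ℝ
    0<-1 = subst₂ _<_ (-‿inverseʳ 1ℝ) (+-identityˡ (- 1ℝ)) (+-mono-< (- 1ℝ) 1<0)
    -1*-1≡1 : - 1ℝ * - 1ℝ ≡ 1ℝ
    -1*-1≡1 = trans (-1*x≈-x (- 1ℝ)) (-‿involutive 1ℝ)

  *-monoˡ-< : ∀ {z x y} → 0ℝ < z → x < y → z * x < z * y
  *-monoˡ-< {z} {x} {y} 0<z x<y = begin-strict
    z * x                  ≡⟨ +-identityˡ (z * x) ⟨
    0ℝ + z * x             <⟨ +-mono-< (z * x) (*-pos 0<z 0<y-x) ⟩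
    z * (y - x) + z * x    ≡⟨ distribˡ z (y - x) x ⟨
    z * ((y - x) + x)      ≡⟨ cong (z *_) (//-rightDividesˡ x y) ⟩
    z * y                  ∎
    where
    0<y-x : 0ℝ < y - x
    0<y-x = subst (_< y - x) (-‿inverseʳ x) (+-mono-< (- x) x<y)

  *-monoˡ-≤ : ∀ {z x y} → 0ℝ ≤ z → x ≤ y → z * x ≤ z * y
  *-monoˡ-≤ (inj₁ 0<z) (inj₁ x<y) = inj₁ (*-monoˡ-< 0<z x<y)
  *-monoˡ-≤ _ (inj₂ refl) = ≤-refl
  *-monoˡ-≤ {x = x} {y} (inj₂ refl) _ = inj₂ (trans (zeroˡ x) (sym (zeroˡ y)))

  *-monoʳ-≤ : ∀ {z x y} → 0ℝ ≤ z → x ≤ y → x * z ≤ y * z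
  *-monoʳ-≤ {z} {x} {y} 0≤z x≤y = subst₂ _≤_ (*-comm z x) (*-comm z y) (*-monoˡ-≤ 0≤z x≤y)

  *-cancelˡ-≤ : ∀ {z x y} → 0ℝ < z → z * x ≤ z * y → x ≤ y
  *-cancelˡ-≤ 0<z zx≤zy = ≮⇒≥ λ y<x → <⇒≱ (*-monoˡ-< 0<z y<x) zx≤zy

  *-cancelˡ-< : ∀ {z x y} → 0ℝ < z → z * x < z * y → x < y
  *-cancelˡ-< {z} {x} {y} 0<z zx<zy with compare x y
  ... | tri< x<y _ _ = x<y
  ... | tri≈ _ refl _ = ⊥-elim (<-irrefl zx<zy)
  ... | tri> _ _ y<x = ⊥-elim (<-asym zx<zy (*-monoˡ-< 0<z y<x))

  0≤* : ∀ {x y} → 0ℝ ≤ x → 0ℝ ≤ y → 0ℝ ≤ x * y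
  0≤* {x} {y} 0≤x 0≤y = subst (_≤ x * y) (zeroʳ x) (*-monoˡ-≤ 0≤x 0≤y)

  *-inverseʳ : ∀ {x} → 0ℝ < x → x * x ⁻¹ ≡ 1ℝ
  *-inverseʳ {x} 0<x = ⁻¹-inverse x λ x≡0 → <-irrefl (subst (0ℝ <_) x≡0 0<x)

  0<⁻¹ : ∀ {x} → 0ℝ < x → 0ℝ < x ⁻¹
  0<⁻¹ {x} 0<x with compare 0ℝ (x ⁻¹)
  ... | tri< 0<x⁻¹ _ _ = 0<x⁻¹
  ... | tri≈ _ 0≡x⁻¹ _ =
    ⊥-elim (0≢1 (trans (sym (zeroʳ x)) (trans (cong (x *_) 0≡x⁻¹) (*-inverseʳ 0<x))))
  ... | tri> _ _ x⁻¹<0 = ⊥-elim (<-asym 0<1 (subst₂ _<_ (*-inverseʳ 0<x) (zeroʳ x) (*-monoˡ-< 0<x x⁻¹<0)))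

  x÷y*y≡x : ∀ {x y} → 0ℝ < y → x * y ⁻¹ * y ≡ x
  x÷y*y≡x {x} {y} 0<y = begin-equality
    x * y ⁻¹ * y     ≡⟨ *-assoc x (y ⁻¹) y ⟩
    x * (y ⁻¹ * y)   ≡⟨ cong (x *_) (trans (*-comm (y ⁻¹) y) (*-inverseʳ 0<y)) ⟩
    x * 1ℝ           ≡⟨ *-identityʳ x ⟩
    x                ∎

  x*[y÷x]≡y : ∀ {x y} → 0ℝ < x → x * (y * x ⁻¹) ≡ y
  x*[y÷x]≡y {x} 0<x = trans (*-comm x _) (x÷y*y≡x 0<x)

  x*[y÷x*z]≡y*z : ∀ {x y z} → 0ℝ < x → x * ((y * x ⁻¹) * z) ≡ y * z
  x*[y÷x*z]≡y*z {x} {z = z} 0<x = trans (sym (*-assoc x _ z)) (cong (_* z) (x*[y÷x]≡y 0<x))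

  ÷≤⇒≤* : ∀ {x y w} → 0ℝ < y → x * y ⁻¹ ≤ w → x ≤ w * y
  ÷≤⇒≤* {x} {y} {w} 0<y x/y≤w = begin
    x                ≡⟨ x÷y*y≡x 0<y ⟨
    x * y ⁻¹ * y     ≤⟨ *-monoʳ-≤ (inj₁ 0<y) x/y≤w ⟩
    w * y            ∎

  ≤*⇒÷≤ : ∀ {x y w} → 0ℝ < y → x ≤ w * y → x * y ⁻¹ ≤ w
  ≤*⇒÷≤ {x} {y} {w} 0<y x≤wy = begin
    x * y ⁻¹         ≤⟨ *-monoʳ-≤ (inj₁ (0<⁻¹ 0<y)) x≤wy ⟩
    w * y * y ⁻¹     ≡⟨ *-assoc w y (y ⁻¹) ⟩
    w * (y * y ⁻¹)   ≡⟨ cong (w *_) (*-inverseʳ 0<y) ⟩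
    w * 1ℝ           ≡⟨ *-identityʳ w ⟩
    w                ∎

  0≤fromℕ : ∀ k → 0ℝ ≤ fromℕ k
  0≤fromℕ ℕ.zero = ≤-refl
  0≤fromℕ (ℕ.suc k) = 0≤+ (inj₁ 0<1) (0≤fromℕ k)

  0<fromℕ-suc : ∀ k → 0ℝ < fromℕ (ℕ.suc k)
  0<fromℕ-suc k = <-≤-trans 0<1 (x≤x+y (0≤fromℕ k))

  0<fromℕ : ∀ {n} → Fin n → 0ℝ < fromℕ n
  0<fromℕ {ℕ.suc n} _ = 0<fromℕ-suc n

  fromℕ-mono : ∀ {m k} → m ℕ.≤ k → fromℕ m ≤ fromℕ k
  fromℕ-mono {k = k} ℕ.z≤n = 0≤fromℕ k
  fromℕ-mono (ℕ.s≤s m≤k) = +-monoˡ-≤ 1ℝ (fromℕ-mono m≤k)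

  -- The numeral that the ring solver denotes by con k.
  #_ : ℕ → ℝ
  # k = k ×ℝ 1ℝ

  fromℕ≡# : ∀ k → fromℕ k ≡ # k
  fromℕ≡# ℕ.zero = refl
  fromℕ≡# (ℕ.suc k) = trans (cong (1ℝ +_) (fromℕ≡# k)) (sym (1+× k 1ℝ))

  0≤# : ∀ k → 0ℝ ≤ # k
  0≤# k = subst (0ℝ ≤_) (fromℕ≡# k) (0≤fromℕ k)

  0<# : ∀ k → 0ℝ < # ℕ.suc k
  0<# k = subst (0ℝ <_) (fromℕ≡# (ℕ.suc k)) (0<fromℕ-suc k)

  x≤max : ∀ x y → x ≤ max x y
  x≤max x y with compare x y
  ... | tri< x<y _ _ = inj₁ x<y
  ... | tri≈ _ x≡y _ = inj₂ x≡y
  ... | tri> _ _ _ = ≤-refl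

  y≤max : ∀ x y → y ≤ max x y
  y≤max x y with compare x y
  ... | tri< _ _ _ = ≤-refl
  ... | tri≈ _ _ _ = ≤-refl
  ... | tri> _ _ y<x = inj₁ y<x

  max-lub : ∀ {x y w} → x ≤ w → y ≤ w → max x y ≤ w
  max-lub {x} {y} x≤w y≤w with compare x y
  ... | tri< _ _ _ = y≤w
  ... | tri≈ _ _ _ = y≤w
  ... | tri> _ _ _ = x≤w

  div-pos : ∀ {x y} → 0ℝ < y → div x y ≡ fin (x * y ⁻¹)
  div-pos {x} {y} 0<y with compare y 0ℝ
  ... | tri< _ _ _ = refl
  ... | tri≈ _ y≡0 _ = ⊥-elim (<-irrefl (subst (0ℝ <_) y≡0 0<y))
  ... | tri> _ _ _ = refl

  div-zero : ∀ {x} → div x 0ℝ ≡ ∞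
  div-zero with compare 0ℝ 0ℝ
  ... | tri< 0<0 _ _ = ⊥-elim (<-irrefl 0<0)
  ... | tri≈ _ _ _ = refl
  ... | tri> _ _ 0<0 = ⊥-elim (<-irrefl 0<0)

  ratio : ℝ → ℝ → Ext
  ratio a b = maxᵉ (div a b) (div b a)

  ratio-pos : ∀ {a b} → 0ℝ < a → 0ℝ < b → ratio a b ≡ fin (max (a * b ⁻¹) (b * a ⁻¹))
  ratio-pos 0<a 0<b = cong₂ maxᵉ (div-pos 0<b) (div-pos 0<a)

  WithinFactor : ℝ → ℝ → ℝ → Set
  WithinFactor w a b = 0ℝ < a × 0ℝ < b × a ≤ w * b × b ≤ w * a

  ratio≤⇒withinFactor : ∀ {a b w} → 0ℝ ≤ a → 0ℝ ≤ b → ratio a b ≤ᵉ fin w → WithinFactor w a b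
  ratio≤⇒withinFactor {a} _ (inj₂ refl) r≤w with div a 0ℝ | div-zero {a}
  ... | _ | refl with r≤w
  ... | ()
  ratio≤⇒withinFactor {b = b} (inj₂ refl) (inj₁ 0<b) r≤w
    with div 0ℝ b | div-pos {0ℝ} 0<b | div b 0ℝ | div-zero {b}
  ... | _ | refl | _ | refl with r≤w
  ... | ()
  ratio≤⇒withinFactor (inj₁ 0<a) (inj₁ 0<b) r≤w with subst (_≤ᵉ _) (ratio-pos 0<a 0<b) r≤w
  ... | fin≤fin max≤w =
    0<a , 0<b , ÷≤⇒≤* 0<b (≤-trans (x≤max _ _) max≤w) , ÷≤⇒≤* 0<a (≤-trans (y≤max _ _) max≤w)

  withinFactor⇒ratio≤ : ∀ {a b w} → WithinFactor w a b → ratio a b ≤ᵉ fin w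
  withinFactor⇒ratio≤ (0<a , 0<b , a≤wb , b≤wa) =
    subst (_≤ᵉ _) (sym (ratio-pos 0<a 0<b)) (fin≤fin (max-lub (≤*⇒÷≤ 0<b a≤wb) (≤*⇒÷≤ 0<a b≤wa)))

  withinFactor⇒1≤ : ∀ {w a b} → WithinFactor w a b → 1ℝ ≤ w
  withinFactor⇒1≤ {w} {a} {b} (0<a , 0<b , a≤wb , b≤wa) = ≮⇒≥ λ w<1 → begin-contradiction
    a        ≤⟨ a≤wb ⟩
    w * b    <⟨ shrink 0<b w<1 ⟩
    b        ≤⟨ b≤wa ⟩
    w * a    <⟨ shrink 0<a w<1 ⟩
    a        ∎
    where
    shrink : ∀ {x} → 0ℝ < x → w < 1ℝ → w * x < x
    shrink {x} 0<x w<1 = subst₂ _<_ (*-comm x w) (*-identityʳ x) (*-monoˡ-< 0<x w<1)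

  ≤⊎≤⇒≤* : ∀ {m a b w} → 0ℝ ≤ a → 1ℝ ≤ w → b ≤ w * a → m ≤ a ⊎ m ≤ b → m ≤ w * a
  ≤⊎≤⇒≤* {m} {a} {b} {w} 0≤a 1≤w _ (inj₁ m≤a) = begin
    m         ≤⟨ m≤a ⟩
    a         ≡⟨ *-identityˡ a ⟨
    1ℝ * a    ≤⟨ *-monoʳ-≤ 0≤a 1≤w ⟩
    w * a     ∎
  ≤⊎≤⇒≤* _ _ b≤wa (inj₂ m≤b) = ≤-trans m≤b b≤wa

module Rounding (ℛ : RealField) where
  open Reals ℛ
  open OrderedField ℛ
  open ≤-Reasoning
  open CommutativeRing commutativeRing using (*-assoc; *-identityˡ; zeroʳ)
  open NaturalCoefficientsSolver (CommutativeRing.commutativeSemiring commutativeRing)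
    using (solve; _:+_; _:*_; _:=_; con)

  Σ-nonneg : ∀ {n} {J : Fin n → ℝ} → (∀ i → 0ℝ ≤ J i) → ∀ Z → 0ℝ ≤ Σ[ J ] Z
  Σ-nonneg J≥0 [] = ≤-refl
  Σ-nonneg J≥0 (inside ∷ Z) = 0≤+ (J≥0 zero) (Σ-nonneg (λ i → J≥0 (suc i)) Z)
  Σ-nonneg J≥0 (outside ∷ Z) = 0≤+ ≤-refl (Σ-nonneg (λ i → J≥0 (suc i)) Z)

  ∈⇒≤Σ : ∀ {n} {J : Fin n → ℝ} → (∀ i → 0ℝ ≤ J i) → ∀ {Z i} → i ∈ Z → J i ≤ Σ[ J ] Z
  ∈⇒≤Σ J≥0 {inside ∷ Z} here = x≤x+y (Σ-nonneg (λ i → J≥0 (suc i)) Z)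
  ∈⇒≤Σ J≥0 {inside ∷ _} (there i∈Z) = ≤-trans (∈⇒≤Σ (λ i → J≥0 (suc i)) i∈Z) (y≤x+y (J≥0 zero))
  ∈⇒≤Σ J≥0 {outside ∷ _} (there i∈Z) = ≤-trans (∈⇒≤Σ (λ i → J≥0 (suc i)) i∈Z) (y≤x+y ≤-refl)

  Σ-mono : ∀ {n} {A B : Fin n → ℝ} → (∀ i → A i ≤ B i) → ∀ Z → Σ[ A ] Z ≤ Σ[ B ] Z
  Σ-mono A≤B [] = ≤-refl
  Σ-mono A≤B (inside ∷ Z) = +-mono-≤ (A≤B zero) (Σ-mono (λ i → A≤B (suc i)) Z)
  Σ-mono A≤B (outside ∷ Z) = +-monoˡ-≤ 0ℝ (Σ-mono (λ i → A≤B (suc i)) Z)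

  Σ-≤-+ : ∀ {n δ} {A B : Fin n → ℝ} → 0ℝ ≤ δ → (∀ i → B i ≤ A i + δ) → ∀ Z →
          Σ[ B ] Z ≤ Σ[ A ] Z + fromℕ n * δ
  Σ-≤-+ {δ = δ} _ _ [] = inj₂ (solve 1 (λ δ → con 0 := con 0 :+ con 0 :* δ) refl δ)
  Σ-≤-+ {ℕ.suc n} {δ} {A} {B} 0≤δ B≤A+δ (inside ∷ Z) = begin
    B zero + Σ[ (λ i → B (suc i)) ] Z
      ≤⟨ +-mono-≤ (B≤A+δ zero) (Σ-≤-+ 0≤δ (λ i → B≤A+δ (suc i)) Z) ⟩
    (A zero + δ) + (Σ[ (λ i → A (suc i)) ] Z + fromℕ n * δ)
      ≡⟨ solve 4 (λ a δ s k → (a :+ δ) :+ (s :+ k :* δ) := (a :+ s) :+ (con 1 :+ k) :* δ)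
               refl (A zero) δ (Σ[ (λ i → A (suc i)) ] Z) (fromℕ n) ⟩
    (A zero + Σ[ (λ i → A (suc i)) ] Z) + fromℕ (ℕ.suc n) * δ
      ∎
  Σ-≤-+ {ℕ.suc n} {δ} {A} {B} 0≤δ B≤A+δ (outside ∷ Z) = begin
    0ℝ + Σ[ (λ i → B (suc i)) ] Z
      ≤⟨ +-mono-≤ (x≤x+y 0≤δ) (Σ-≤-+ 0≤δ (λ i → B≤A+δ (suc i)) Z) ⟩
    (0ℝ + δ) + (Σ[ (λ i → A (suc i)) ] Z + fromℕ n * δ)
      ≡⟨ solve 3 (λ δ s k → (con 0 :+ δ) :+ (s :+ k :* δ) := (con 0 :+ s) :+ (con 1 :+ k) :* δ)
               refl δ (Σ[ (λ i → A (suc i)) ] Z) (fromℕ n) ⟩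
    (0ℝ + Σ[ (λ i → A (suc i)) ] Z) + fromℕ (ℕ.suc n) * δ
      ∎

  maxIn⇒≤Σ : ∀ {n} {J : Fin n → ℝ} {X Y} → (∀ i → 0ℝ ≤ J i) → MaxIn J X Y →
             ∀ {m} j → m ≤ J j → m ≤ Σ[ J ] X ⊎ m ≤ Σ[ J ] Y
  maxIn⇒≤Σ J≥0 (i , inj₁ i∈X , J≤Ji) j m≤Jj = inj₁ (≤-trans (≤-trans m≤Jj (J≤Ji j)) (∈⇒≤Σ J≥0 i∈X))
  maxIn⇒≤Σ J≥0 (i , inj₂ i∈Y , J≤Ji) j m≤Jj = inj₂ (≤-trans (≤-trans m≤Jj (J≤Ji j)) (∈⇒≤Σ J≥0 i∈Y))

  roundUp-≥ : ∀ {n δ} {I Ĩ : Fin n → ℝ} → RoundUp δ I Ĩ → ∀ i → I i ≤ Ĩ i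
  roundUp-≥ rounding i with rounding i
  ... | _ , _ , I≤Ĩ , _ = I≤Ĩ

  roundUp-mono : ∀ {n δ} {I Ĩ : Fin n → ℝ} → 0ℝ < δ → RoundUp δ I Ĩ → ∀ {i j} → I j ≤ I i → Ĩ j ≤ Ĩ i
  roundUp-mono {δ = δ} {I} {Ĩ} 0<δ rounding {i} {j} Ij≤Ii with rounding i | rounding j
  ... | mi , Ĩi≡miδ , Ii≤Ĩi , _ | mj , Ĩj≡mjδ , _ , Ĩj<Ij+δ with ℕ.≤-<-connex mj mi
  ... | inj₁ mj≤mi = begin
    Ĩ j             ≡⟨ Ĩj≡mjδ ⟩
    fromℕ mj * δ    ≤⟨ *-monoʳ-≤ (inj₁ 0<δ) (fromℕ-mono mj≤mi) ⟩
    fromℕ mi * δ    ≡⟨ Ĩi≡miδ ⟨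
    Ĩ i             ∎
  ... | inj₂ mi<mj = begin-contradiction
    Ĩ j                     <⟨ Ĩj<Ij+δ ⟩
    I j + δ                 ≤⟨ +-monoʳ-≤ δ (≤-trans Ij≤Ii Ii≤Ĩi) ⟩
    Ĩ i + δ                 ≡⟨ cong (_+ δ) Ĩi≡miδ ⟩
    fromℕ mi * δ + δ        ≡⟨ solve 2 (λ k δ → k :* δ :+ δ := (con 1 :+ k) :* δ) refl (fromℕ mi) δ ⟩
    fromℕ (ℕ.suc mi) * δ    ≤⟨ *-monoʳ-≤ (inj₁ 0<δ) (fromℕ-mono mi<mj) ⟩
    fromℕ mj * δ            ≡⟨ Ĩj≡mjδ ⟨
    Ĩ j                     ∎

  roundUp-maxIn : ∀ {n δ} {I Ĩ : Fin n → ℝ} {X Y} → 0ℝ < δ → RoundUp δ I Ĩ → MaxIn I X Y → MaxIn Ĩ X Y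
  roundUp-maxIn 0<δ rounding (i , i∈X∪Y , I≤Ii) = i , i∈X∪Y , λ j → roundUp-mono 0<δ rounding (I≤Ii j)

  UpperApprox : ℝ → ℝ → ℝ → Set
  UpperApprox D a ã = a ≤ ã × ã ≤ a + D

  roundUp⇒Σ-upperApprox : ∀ {n δ} {I Ĩ : Fin n → ℝ} → 0ℝ ≤ δ → RoundUp δ I Ĩ →
                          ∀ Z → UpperApprox (fromℕ n * δ) (Σ[ I ] Z) (Σ[ Ĩ ] Z)
  roundUp⇒Σ-upperApprox {δ = δ} {I} {Ĩ} 0≤δ rounding Z = Σ-mono (roundUp-≥ rounding) Z , Σ-≤-+ 0≤δ Ĩ≤I+δ Z
    where
    Ĩ≤I+δ : ∀ i → Ĩ i ≤ I i + δ
    Ĩ≤I+δ i with rounding i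
    ... | _ , _ , _ , Ĩ<I+δ = inj₁ Ĩ<I+δ

  δ≤[ε/kn]M⇒nδ≤[ε/k]M : ∀ {k n δ ε M} → 0ℝ < k → 0ℝ < n →
                         δ ≤ (ε * (k * n) ⁻¹) * M → n * δ ≤ (ε * k ⁻¹) * M
  δ≤[ε/kn]M⇒nδ≤[ε/k]M {k} {n} {δ} {ε} {M} 0<k 0<n δ≤[ε/kn]M = *-cancelˡ-≤ 0<k (begin
    k * (n * δ)                        ≡⟨ *-assoc k n δ ⟨
    (k * n) * δ                        ≤⟨ *-monoˡ-≤ (inj₁ 0<kn) δ≤[ε/kn]M ⟩
    (k * n) * ((ε * (k * n) ⁻¹) * M)   ≡⟨ x*[y÷x*z]≡y*z 0<kn ⟩
    ε * M                              ≡⟨ x*[y÷x*z]≡y*z 0<k ⟨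
    k * ((ε * k ⁻¹) * M)               ∎)
    where
    0<kn : 0ℝ < k * n
    0<kn = *-pos 0<k 0<n

  rounded-ratio-bound : ∀ {ρ η M D p q p̃ q̃} → 0ℝ ≤ ρ → 0ℝ ≤ η → D ≤ η * M → M ≤ # 2 * q →
                        p̃ ≤ p + D → q ≤ q̃ → p ≤ ρ * q → p̃ ≤ (ρ + # 2 * η) * q̃
  rounded-ratio-bound {ρ} {η} {M} {D} {p} {q} {p̃} {q̃} 0≤ρ 0≤η D≤ηM M≤2q p̃≤p+D q≤q̃ p≤ρq = begin
    p̃                        ≤⟨ p̃≤p+D ⟩
    p + D                    ≤⟨ +-mono-≤ p≤ρq (≤-trans D≤ηM (*-monoˡ-≤ 0≤η M≤2q)) ⟩
    ρ * q + η * (# 2 * q)    ≡⟨ solve 3 (λ ρ η q → ρ :* q :+ η :* (con 2 :* q) := (ρ :+ con 2 :* η) :* q) refl ρ η q ⟩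
    (ρ + # 2 * η) * q        ≤⟨ *-monoˡ-≤ (0≤+ 0≤ρ (0≤* (0≤# 2) 0≤η)) q≤q̃ ⟩
    (ρ + # 2 * η) * q̃        ∎

  rounded-withinFactor : ∀ {ρ η M D p q p̃ q̃} → ρ ≤ # 2 → 0ℝ ≤ η → D ≤ η * M → M ≤ p ⊎ M ≤ q →
                         UpperApprox D p p̃ → UpperApprox D q q̃ →
                         WithinFactor ρ p q → WithinFactor (ρ + # 2 * η) p̃ q̃
  rounded-withinFactor {ρ} {M = M} ρ≤2 0≤η D≤ηM M≤p⊎q (p≤p̃ , p̃≤p+D) (q≤q̃ , q̃≤q+D)
                       p,q-within@(0<p , 0<q , p≤ρq , q≤ρp) =
    <-≤-trans 0<p p≤p̃ ,
    <-≤-trans 0<q q≤q̃ ,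
    rounded-ratio-bound 0≤ρ 0≤η D≤ηM (M≤2*side 0<q p≤ρq (swap M≤p⊎q)) p̃≤p+D q≤q̃ p≤ρq ,
    rounded-ratio-bound 0≤ρ 0≤η D≤ηM (M≤2*side 0<p q≤ρp M≤p⊎q) q̃≤q+D p≤p̃ q≤ρp
    where
    1≤ρ : 1ℝ ≤ ρ
    1≤ρ = withinFactor⇒1≤ p,q-within
    0≤ρ : 0ℝ ≤ ρ
    0≤ρ = ≤-trans (inj₁ 0<1) 1≤ρ
    M≤2*side : ∀ {a b} → 0ℝ < a → b ≤ ρ * a → M ≤ a ⊎ M ≤ b → M ≤ # 2 * a
    M≤2*side 0<a b≤ρa M≤a⊎b = ≤-trans (≤⊎≤⇒≤* (inj₁ 0<a) 1≤ρ b≤ρa M≤a⊎b) (*-monoʳ-≤ (inj₁ 0<a) ρ≤2)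

  [ρ+2η][2+9η]≤2[1+9η]ρ : ∀ {ρ η} → 1ℝ ≤ ρ → 0ℝ ≤ η → # 9 * η ≤ 1ℝ →
                          (ρ + # 2 * η) * (# 2 + # 9 * η) ≤ # 2 * ((1ℝ + # 9 * η) * ρ)
  [ρ+2η][2+9η]≤2[1+9η]ρ {ρ} {η} 1≤ρ 0≤η 9η≤1 = begin
    (ρ + # 2 * η) * (# 2 + # 9 * η)
      ≡⟨ solve 2 (λ ρ η → (ρ :+ con 2 :* η) :* (con 2 :+ con 9 :* η)
                        := con 2 :* ρ :+ con 9 :* η :* ρ :+ η :* (con 4 :+ con 2 :* (con 9 :* η))) refl ρ η ⟩
    # 2 * ρ + # 9 * η * ρ + η * (# 4 + # 2 * (# 9 * η))
      ≤⟨ +-monoˡ-≤ _ (*-monoˡ-≤ 0≤η 4+18η≤9ρ) ⟩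
    # 2 * ρ + # 9 * η * ρ + η * (# 9 * ρ)
      ≡⟨ solve 2 (λ ρ η → con 2 :* ρ :+ con 9 :* η :* ρ :+ η :* (con 9 :* ρ)
                        := con 2 :* ((con 1 :+ con 9 :* η) :* ρ)) refl ρ η ⟩
    # 2 * ((1ℝ + # 9 * η) * ρ)
      ∎
    where
    4+18η≤9ρ : # 4 + # 2 * (# 9 * η) ≤ # 9 * ρ
    4+18η≤9ρ = begin
      # 4 + # 2 * (# 9 * η)    ≤⟨ +-monoˡ-≤ (# 4) (*-monoˡ-≤ (0≤# 2) 9η≤1) ⟩
      # 4 + # 2 * 1ℝ           ≤⟨ x≤x+y (0≤# 3) ⟩
      # 4 + # 2 * 1ℝ + # 3     ≡⟨ solve 0 (con 4 :+ con 2 :* con 1 :+ con 3 := con 9 :* con 1) refl ⟩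
      # 9 * 1ℝ                 ≤⟨ *-monoˡ-≤ (0≤# 9) 1≤ρ ⟩
      # 9 * ρ                  ∎

  unrounded-lower-bound : ∀ {η D x x̃} → 0ℝ ≤ x̃ → # 9 * η ≤ 1ℝ → D ≤ # 3 * η * x̃ → x̃ ≤ x + D →
                          # 2 * x̃ ≤ # 3 * x
  unrounded-lower-bound {η} {D} {x} {x̃} 0≤x̃ 9η≤1 D≤3ηx̃ x̃≤x+D = +-cancelʳ-≤ x̃ (begin
    # 2 * x̃ + x̃                ≡⟨ solve 1 (λ x̃ → con 2 :* x̃ :+ x̃ := con 3 :* x̃) refl x̃ ⟩
    # 3 * x̃                    ≤⟨ *-monoˡ-≤ (0≤# 3) (≤-trans x̃≤x+D (+-monoˡ-≤ x D≤3ηx̃)) ⟩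
    # 3 * (x + # 3 * η * x̃)    ≡⟨ solve 3 (λ x η x̃ → con 3 :* (x :+ con 3 :* η :* x̃) := con 3 :* x :+ con 9 :* η :* x̃) refl x η x̃ ⟩
    # 3 * x + # 9 * η * x̃      ≤⟨ +-monoˡ-≤ _ (*-monoʳ-≤ 0≤x̃ 9η≤1) ⟩
    # 3 * x + 1ℝ * x̃           ≡⟨ cong (_ +_) (*-identityˡ x̃) ⟩
    # 3 * x + x̃                ∎)

  unrounded-ratio-bound : ∀ {ρ η D x y x̃ ỹ} → 1ℝ ≤ ρ → 0ℝ ≤ η → # 9 * η ≤ 1ℝ → 0ℝ ≤ x →
                          D ≤ # 3 * η * x̃ → # 2 * x̃ ≤ # 3 * x → x̃ ≤ x + D → y ≤ ỹ →
                          ỹ ≤ (ρ + # 2 * η) * x̃ → y ≤ ((1ℝ + # 9 * η) * ρ) * x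
  unrounded-ratio-bound {ρ} {η} {D} {x} {y} {x̃} {ỹ} 1≤ρ 0≤η 9η≤1 0≤x D≤3ηx̃ 2x̃≤3x x̃≤x+D y≤ỹ ỹ≤σx̃ =
    *-cancelˡ-≤ (0<# 1) (begin
    # 2 * y                                  ≤⟨ *-monoˡ-≤ (0≤# 2) (≤-trans y≤ỹ ỹ≤σx̃) ⟩
    # 2 * ((ρ + # 2 * η) * x̃)                ≤⟨ *-monoˡ-≤ (0≤# 2) (*-monoˡ-≤ 0≤σ x̃≤x+D) ⟩
    # 2 * ((ρ + # 2 * η) * (x + D))          ≡⟨ solve 4 (λ ρ η x D → con 2 :* ((ρ :+ con 2 :* η) :* (x :+ D))
                                                                   := (ρ :+ con 2 :* η) :* (con 2 :* x :+ con 2 :* D)) refl ρ η x D ⟩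
    (ρ + # 2 * η) * (# 2 * x + # 2 * D)      ≤⟨ *-monoˡ-≤ 0≤σ (+-monoˡ-≤ _ 2D≤9ηx) ⟩
    (ρ + # 2 * η) * (# 2 * x + # 9 * η * x)  ≡⟨ solve 3 (λ ρ η x → (ρ :+ con 2 :* η) :* (con 2 :* x :+ con 9 :* η :* x)
                                                                   := (ρ :+ con 2 :* η) :* (con 2 :+ con 9 :* η) :* x) refl ρ η x ⟩
    (ρ + # 2 * η) * (# 2 + # 9 * η) * x      ≤⟨ *-monoʳ-≤ 0≤x ([ρ+2η][2+9η]≤2[1+9η]ρ 1≤ρ 0≤η 9η≤1) ⟩
    # 2 * ((1ℝ + # 9 * η) * ρ) * x           ≡⟨ *-assoc (# 2) _ x ⟩
    # 2 * ((1ℝ + # 9 * η) * ρ * x)           ∎)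
    where
    0≤σ : 0ℝ ≤ ρ + # 2 * η
    0≤σ = 0≤+ (≤-trans (inj₁ 0<1) 1≤ρ) (0≤* (0≤# 2) 0≤η)
    2D≤9ηx : # 2 * D ≤ # 9 * η * x
    2D≤9ηx = begin
      # 2 * D                  ≤⟨ *-monoˡ-≤ (0≤# 2) D≤3ηx̃ ⟩
      # 2 * (# 3 * η * x̃)      ≡⟨ solve 2 (λ η x̃ → con 2 :* (con 3 :* η :* x̃) := con 3 :* η :* (con 2 :* x̃)) refl η x̃ ⟩
      # 3 * η * (# 2 * x̃)      ≤⟨ *-monoˡ-≤ (0≤* (0≤# 3) 0≤η) 2x̃≤3x ⟩
      # 3 * η * (# 3 * x)      ≡⟨ solve 2 (λ η x → con 3 :* η :* (con 3 :* x) := con 9 :* η :* x) refl η x ⟩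
      # 9 * η * x              ∎

  unrounded-withinFactor : ∀ {ρ η M D x y x̃ ỹ} → 1ℝ ≤ ρ → ρ ≤ # 2 → 0ℝ ≤ η → # 9 * η ≤ 1ℝ →
                           D ≤ η * M → M ≤ x̃ ⊎ M ≤ ỹ → UpperApprox D x x̃ → UpperApprox D y ỹ →
                           WithinFactor (ρ + # 2 * η) x̃ ỹ → WithinFactor ((1ℝ + # 9 * η) * ρ) x y
  unrounded-withinFactor {ρ} {η} {M} {D} {x} {y} {x̃} {ỹ} 1≤ρ ρ≤2 0≤η 9η≤1 D≤ηM M≤x̃⊎ỹ (x≤x̃ , x̃≤x+D) (y≤ỹ , ỹ≤y+D)
                         (0<x̃ , 0<ỹ , x̃≤σỹ , ỹ≤σx̃) =
    0<x , 0<y ,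
    unrounded-ratio-bound 1≤ρ 0≤η 9η≤1 (inj₁ 0<y) D≤3ηỹ 2ỹ≤3y ỹ≤y+D x≤x̃ x̃≤σỹ ,
    unrounded-ratio-bound 1≤ρ 0≤η 9η≤1 (inj₁ 0<x) D≤3ηx̃ 2x̃≤3x x̃≤x+D y≤ỹ ỹ≤σx̃
    where
    σ≤3 : ρ + # 2 * η ≤ # 3
    σ≤3 = begin
      ρ + # 2 * η                ≤⟨ +-mono-≤ ρ≤2 (x≤x+y (0≤* (0≤# 7) 0≤η)) ⟩
      # 2 + (# 2 * η + # 7 * η)  ≡⟨ cong (# 2 +_) (solve 1 (λ η → con 2 :* η :+ con 7 :* η := con 9 :* η) refl η) ⟩
      # 2 + # 9 * η              ≤⟨ +-monoˡ-≤ (# 2) 9η≤1 ⟩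
      # 3                        ∎
    1≤σ : 1ℝ ≤ ρ + # 2 * η
    1≤σ = ≤-trans 1≤ρ (x≤x+y (0≤* (0≤# 2) 0≤η))
    D≤3η*side : ∀ {a b} → 0ℝ < a → M ≤ a ⊎ M ≤ b → b ≤ (ρ + # 2 * η) * a → D ≤ # 3 * η * a
    D≤3η*side {a} 0<a M≤a⊎b b≤σa = begin
      D              ≤⟨ D≤ηM ⟩
      η * M          ≤⟨ *-monoˡ-≤ 0≤η (≤-trans (≤⊎≤⇒≤* (inj₁ 0<a) 1≤σ b≤σa M≤a⊎b) (*-monoʳ-≤ (inj₁ 0<a) σ≤3)) ⟩
      η * (# 3 * a)  ≡⟨ solve 2 (λ η a → η :* (con 3 :* a) := con 3 :* η :* a) refl η a ⟩
      # 3 * η * a    ∎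
    side-pos : ∀ {a ã} → 0ℝ < ã → # 2 * ã ≤ # 3 * a → 0ℝ < a
    side-pos {a} {ã} 0<ã 2ã≤3a = *-cancelˡ-< (0<# 2) (begin-strict
      # 3 * 0ℝ     ≡⟨ zeroʳ (# 3) ⟩
      0ℝ           <⟨ *-pos (0<# 1) 0<ã ⟩
      # 2 * ã      ≤⟨ 2ã≤3a ⟩
      # 3 * a      ∎)
    D≤3ηx̃ : D ≤ # 3 * η * x̃
    D≤3ηx̃ = D≤3η*side 0<x̃ M≤x̃⊎ỹ ỹ≤σx̃
    D≤3ηỹ : D ≤ # 3 * η * ỹ
    D≤3ηỹ = D≤3η*side 0<ỹ (swap M≤x̃⊎ỹ) x̃≤σỹ
    2x̃≤3x : # 2 * x̃ ≤ # 3 * x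
    2x̃≤3x = unrounded-lower-bound (inj₁ 0<x̃) 9η≤1 D≤3ηx̃ x̃≤x+D
    2ỹ≤3y : # 2 * ỹ ≤ # 3 * y
    2ỹ≤3y = unrounded-lower-bound (inj₁ 0<ỹ) 9η≤1 D≤3ηỹ ỹ≤y+D
    0<x : 0ℝ < x
    0<x = side-pos 0<x̃ 2x̃≤3x
    0<y : 0ℝ < y
    0<y = side-pos 0<ỹ 2ỹ≤3y

lemma4p11 : (ℛ : RealField) → let open Reals ℛ in
    (n : ℕ) (I : Fin n → ℝ) → Injective _≡_ _≡_ I → (∀ i → 0ℝ < I i) →
    (opt : Ext) → IsOPT I opt → opt ≤ᵉ fin (1ℝ + 1ℝ) →
    (ε : ℝ) → 0ℝ < ε → ε < 1ℝ →
    (M : ℝ) → IsMax I M →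
    (δ : ℝ) → 0ℝ < δ → δ ≤ (ε * ((fromℕ 9 * fromℕ n) ⁻¹)) * M →
    (Ĩ : Fin n → ℝ) → RoundUp δ I Ĩ →
    (X̃ Ỹ : Subset n) → Disjoint X̃ Ỹ → MaxIn Ĩ X̃ Ỹ → IsOPT Ĩ (R Ĩ X̃ Ỹ) →
    R I X̃ Ỹ ≤ᵉ scale (1ℝ + ε) opt
lemma4p11 ℛ n I _ 0<I _ ((P , Q , (P∩Q=∅ , maxIn[P,Q]) , R[P,Q]≡ρ) , _) (Reals.fin≤fin {ρ} ρ≤2)
          ε 0<ε ε<1 M ((iM , I[iM]≡M) , _) δ 0<δ δ≤[ε/9n]M Ĩ rounding X̃ Ỹ _ maxIn[X̃,Ỹ] (_ , X̃,Ỹ-optimal) =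
  withinFactor⇒ratio≤ (subst (λ e → WithinFactor ((1ℝ + e) * ρ) _ _) 9η≡ε
    (unrounded-withinFactor (withinFactor⇒1≤ P,Q-within) ρ≤2 0≤η 9η≤1 D≤ηM
       (maxIn⇒≤Σ Ĩ≥0 maxIn[X̃,Ỹ] iM M≤Ĩ[iM]) (Σ-approx X̃) (Σ-approx Ỹ) X̃,Ỹ-within))
  where
  open Reals ℛ
  open OrderedField ℛ
  open Rounding ℛ
  η : ℝ
  η = ε * fromℕ 9 ⁻¹
  0≤η : 0ℝ ≤ η
  0≤η = inj₁ (*-pos 0<ε (0<⁻¹ (0<fromℕ-suc 8)))
  9η≡ε : # 9 * η ≡ ε
  9η≡ε = subst (λ k → k * η ≡ ε) (fromℕ≡# 9) (x*[y÷x]≡y (0<fromℕ-suc 8))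
  9η≤1 : # 9 * η ≤ 1ℝ
  9η≤1 = subst (_≤ 1ℝ) (sym 9η≡ε) (inj₁ ε<1)
  D≤ηM : fromℕ n * δ ≤ η * M
  D≤ηM = δ≤[ε/kn]M⇒nδ≤[ε/k]M (0<fromℕ-suc 8) (0<fromℕ iM) δ≤[ε/9n]M
  I≥0 : ∀ i → 0ℝ ≤ I i
  I≥0 i = inj₁ (0<I i)
  Ĩ≥0 : ∀ i → 0ℝ ≤ Ĩ i
  Ĩ≥0 i = ≤-trans (I≥0 i) (roundUp-≥ rounding i)
  M≤Ĩ[iM] : M ≤ Ĩ iM
  M≤Ĩ[iM] = subst (_≤ Ĩ iM) I[iM]≡M (roundUp-≥ rounding iM)
  Σ-approx : ∀ Z → UpperApprox (fromℕ n * δ) (Σ[ I ] Z) (Σ[ Ĩ ] Z)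
  Σ-approx = roundUp⇒Σ-upperApprox (inj₁ 0<δ) rounding
  P,Q-within : WithinFactor ρ (Σ[ I ] P) (Σ[ I ] Q)
  P,Q-within = ratio≤⇒withinFactor (Σ-nonneg I≥0 P) (Σ-nonneg I≥0 Q)
                 (subst (_≤ᵉ fin ρ) (sym R[P,Q]≡ρ) (fin≤fin ≤-refl))
  P,Q-within-rounded : WithinFactor (ρ + # 2 * η) (Σ[ Ĩ ] P) (Σ[ Ĩ ] Q)
  P,Q-within-rounded = rounded-withinFactor ρ≤2 0≤η D≤ηM (maxIn⇒≤Σ I≥0 maxIn[P,Q] iM (inj₂ (sym I[iM]≡M)))
                         (Σ-approx P) (Σ-approx Q) P,Q-within
  X̃,Ỹ-within : WithinFactor (ρ + # 2 * η) (Σ[ Ĩ ] X̃) (Σ[ Ĩ ] Ỹ)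
  X̃,Ỹ-within = ratio≤⇒withinFactor (Σ-nonneg Ĩ≥0 X̃) (Σ-nonneg Ĩ≥0 Ỹ)
                 (≤ᵉ-trans (X̃,Ỹ-optimal P Q (P∩Q=∅ , roundUp-maxIn 0<δ rounding maxIn[P,Q]))
                           (withinFactor⇒ratio≤ P,Q-within-rounded))
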